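{- Let $k$ be an algebraically closed field, $n\geq2$, $A$ a finitely generated commutative $k$-algebra with unit without zero divisors, and $S$ the set of $k$-algebra homomorphisms $A\to k$. Let $X$ be an $n\times n$ matrix with entries in $A$ of rank $\leq1$ and let $\mathbf{s}=(s_1,\dots,s_{n+1})\in S^{\{1,\dots,n+1\}}$. (i) If $X$ is $\mathbf{s}$-normalized then $\Delta(X|_{s_1},\dots,X|_{s_{n+1}})\neq0$. (ii) If $\Delta(X|_{s_1},\dots,X|_{s_{n+1}})\neq0$ then $X$ is $k$-general.
   Context: Rank $\leq1$: every $2\times2$ submatrix has zero determinant. $k$-general: some row has $k$-linearly independent entries and some column has $k$-linearly independent entries. For $s\in S$, $X|_s$ is the matrix over $k$ obtained by evaluating each entry at $s$. For $n\times n$ matrices $Y^{(1)},\dots,Y^{(n+1)}$ over a commutative ring, $\Delta(Y^{(1)},\dots,Y^{(n+1)})=\big(\det\sum_{\ell=1}^nY^{(\ell)}\big)^{2n-2}\prod_{i=1}^n\big(\det\sum_{\ell\in\{1,\dots,n+1\}\setminus\{i\}}Y^{(\ell)}\big)^2$. $X$ is $\mathbf{s}$-normalized if (a) for $i,j,\ell\in\{1,\dots,n\}$ we have $X_{ij}|_{s_\ell}\neq0$ if and only if $i=j=\ell$, and (b) $X_{ij}|_{s_{n+1}}=1$ for all $i,j\in\{1,\dots,n\}$. -}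

module Defs where

open import Level using (Level; _⊔_)
open import Data.Nat using (ℕ; zero; suc)
import Data.Nat as ℕ
open import Data.Fin using (Fin; zero; suc; inject₁; fromℕ; punchIn)
open import Data.List using (List; []; _∷_)
import Data.List
open import Data.Product using (Σ; ∃; _×_; _,_)
open import Data.Sum using (_⊎_)
open import Relation.Nullary using (¬_)
open import Relation.Binary.PropositionalEquality using (_≡_)
open import Algebra.Bundles using (CommutativeRing)
open import Algebra.Morphism.Structures using (module RingMorphisms)

private
  variable
    c ℓ a ℓa : Level

module RingOps (R : CommutativeRing c ℓ) where
  open CommutativeRing R using (Carrier; _+_; _*_; -_; 0#; 1#)

  ∑ : ∀ n → (Fin n → Carrier) → Carrier
  ∑ zero    f = 0#
  ∑ (suc n) f = f zero + ∑ n (λ i → f (suc i))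

  ∏ : ∀ n → (Fin n → Carrier) → Carrier
  ∏ zero    f = 1#
  ∏ (suc n) f = f zero * ∏ n (λ i → f (suc i))

  _^_ : Carrier → ℕ → Carrier
  x ^ zero  = 1#
  x ^ suc m = x * (x ^ m)

  sign : ∀ {n} → Fin n → Carrier
  sign zero    = 1#
  sign (suc j) = - (sign j)

  Matrix : ℕ → Set c
  Matrix n = Fin n → Fin n → Carrier

  det : ∀ n → Matrix n → Carrier
  det zero    M = 1#
  det (suc n) M =
    ∑ (suc n) (λ j → sign j * (M zero j * det n (λ i j' → M (suc i) (punchIn j j'))))

  matSum : ∀ {n} m → (Fin m → Matrix n) → Matrix n
  matSum m Y i j = ∑ m (λ ℓ → Y ℓ i j)

  -- Δ(Y⁽¹⁾,…,Y⁽ⁿ⁺¹⁾) ; Y⁽ℓ⁾ for ℓ = 1..n+1 is  Y ℓ'  for ℓ' : Fin (suc n)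
  -- (ℓ' = ℓ - 1), so Y⁽ⁿ⁺¹⁾ = Y (fromℕ n).
  Δ : ∀ n → (Fin (suc n) → Matrix n) → Carrier
  Δ n Y =
    (det n (matSum n (λ ℓ → Y (inject₁ ℓ))) ^ (2 ℕ.* n ℕ.∸ 2))
    * ∏ n (λ i → det n (matSum n (λ ℓ → Y (punchIn (inject₁ i) ℓ))) ^ 2)

module _ (K : CommutativeRing c ℓ) where
  open CommutativeRing K using (Carrier; _+_; _*_; _≈_; _≉_; 0#; 1#)
  open RingOps K using (_^_)

  record IsField : Set (c ⊔ ℓ) where
    field
      1≉0     : 1# ≉ 0#
      inverse : ∀ x → x ≉ 0# → ∃ λ y → x * y ≈ 1#

  -- Horner evaluation of the polynomial with coefficient list
  -- c₀ ∷ c₁ ∷ … (constant term first)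
  evalPoly : List Carrier → Carrier → Carrier
  evalPoly []       x = 0#
  evalPoly (c ∷ cs) x = c + x * evalPoly cs x

  evalMonic : List Carrier → Carrier → Carrier
  evalMonic cs x = evalPoly cs x + (x ^ Data.List.length cs)

  -- every monic polynomial of degree ≥ 1 has a root
  AlgebraicallyClosed : Set (c ⊔ ℓ)
  AlgebraicallyClosed = ∀ (c₀ : Carrier) (cs : List Carrier) →
    ∃ λ x → evalMonic (c₀ ∷ cs) x ≈ 0#

record KAlgebra (K : CommutativeRing c ℓ) (a ℓa : Level)
       : Set (c ⊔ ℓ ⊔ Level.suc (a ⊔ ℓa)) where
  field
    ring : CommutativeRing a ℓa
  open CommutativeRing ring public
    using (Carrier; _+_; _*_; -_; _-_; _≈_; 0#; 1#; rawRing)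
  field
    ι     : CommutativeRing.Carrier K → Carrier
    ι-hom : RingMorphisms.IsRingHomomorphism
              (CommutativeRing.rawRing K) (CommutativeRing.rawRing ring) ι

  _·_ : CommutativeRing.Carrier K → Carrier → Carrier
  λ' · x = ι λ' * x

module _ {K : CommutativeRing c ℓ} (A : KAlgebra K a ℓa) where
  open KAlgebra A
  private
    module K = CommutativeRing K

  data Expr (m : ℕ) : Set c where
    const : K.Carrier → Expr m
    var   : Fin m → Expr m
    _⊕_   : Expr m → Expr m → Expr m
    _⊗_   : Expr m → Expr m → Expr m

  evalExpr : ∀ {m} → (Fin m → Carrier) → Expr m → Carrier
  evalExpr g (const x) = ι x
  evalExpr g (var i)   = g i
  evalExpr g (e ⊕ f)   = evalExpr g e + evalExpr g f
  evalExpr g (e ⊗ f)   = evalExpr g e * evalExpr g f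

  FinitelyGenerated : Set (c ⊔ a ⊔ ℓa)
  FinitelyGenerated = Σ ℕ λ m → Σ (Fin m → Carrier) λ g →
    ∀ (x : Carrier) → ∃ λ (e : Expr m) → evalExpr g e ≈ x

  NoZeroDivisors : Set (a ⊔ ℓa)
  NoZeroDivisors = ∀ x y → x * y ≈ 0# → x ≈ 0# ⊎ y ≈ 0#

  record KAlgHom : Set (c ⊔ ℓ ⊔ a ⊔ ℓa) where
    field
      φ     : Carrier → K.Carrier
      φ-hom : RingMorphisms.IsRingHomomorphism
                (CommutativeRing.rawRing ring) K.rawRing φ
      φ-ι   : ∀ x → φ (ι x) K.≈ x

  open KAlgHom public using (φ)

  MatrixA : ℕ → Set a
  MatrixA n = Fin n → Fin n → Carrier

  _∣at_ : ∀ {n} → MatrixA n → KAlgHom → RingOps.Matrix K n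
  (X ∣at s) i j = φ s (X i j)

  RankLe1 : ∀ {n} → MatrixA n → Set ℓa
  RankLe1 {n} X = ∀ (i i' j j' : Fin n) → ¬ i ≡ i' → ¬ j ≡ j' →
    (X i j * X i' j') - (X i j' * X i' j) ≈ 0#

  LinIndep : ∀ m → (Fin m → Carrier) → Set (c ⊔ ℓ ⊔ ℓa)
  LinIndep m v = ∀ (λs : Fin m → K.Carrier) →
    RingOps.∑ ring m (λ i → λs i · v i) ≈ 0# → ∀ i → λs i K.≈ K.0#

  KGeneral : ∀ {n} → MatrixA n → Set (c ⊔ ℓ ⊔ ℓa)
  KGeneral {n} X =
    (∃ λ (i : Fin n) → LinIndep n (λ j → X i j)) ×
    (∃ λ (j : Fin n) → LinIndep n (λ i → X i j))

  -- s-normalized, with s = (s₁,…,s_{n+1}) given as s : Fin (suc n) → S,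
  -- s_ℓ = s (ℓ-1); s_{n+1} = s (fromℕ n)
  Normalized : ∀ {n} → MatrixA n → (Fin (suc n) → KAlgHom) → Set ℓ
  Normalized {n} X s =
    (∀ (i j ℓ' : Fin n) →
       ((¬ (φ (s (inject₁ ℓ')) (X i j) K.≈ K.0#)) → (i ≡ j × j ≡ ℓ')) ×
       ((i ≡ j × j ≡ ℓ') → ¬ (φ (s (inject₁ ℓ')) (X i j) K.≈ K.0#))) ×
    (∀ (i j : Fin n) → φ (s (fromℕ n)) (X i j) K.≈ K.1#)

-- (i) For normalized X the matrix M = Σ_{ℓ ≤ n} X|_{s_ℓ} is diagonal with nonzero entries
-- d_a = X_aa|_{s_a}.  Leaving out s_i instead of s_{n+1} gives N_i = M − X|_{s_i} + J, J the
-- all-ones matrix: row i of N_i consists of ones and every other row a is row a of M plus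
-- row i.  Subtracting row i from the other rows shows det N_i = ∏_{a ≠ i} d_a, so Δ ≠ 0.
-- (ii) As n ≥ 2 the exponent 2n − 2 is positive, so Δ ≠ 0 forces det M ≠ 0.  If
-- Σ_j λ_j X_1j = 0, rank ≤ 1 gives X_1j₀ · Σ_j λ_j X_ij = X_ij₀ · Σ_j λ_j X_1j = 0; the first
-- row of X is not zero (else det M = 0), so Σ_j λ_j X_ij = 0 for every i.  Evaluating,
-- M λ = 0, hence λ = 0.  Columns follow by transposing X.

module Submission where

open import Defs
open import Level using (Level)
open import Data.Nat using (ℕ; zero; suc; _≤_; s≤s; z≤n)
import Data.Nat as ℕ
open import Data.Fin using (Fin; zero; suc; punchIn; inject₁; fromℕ; _≟_)
open import Data.Fin.Properties using (suc-injective; punchInᵢ≢i; ∀-cons)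
open import Data.Vec.Functional using (updateAt)
open import Data.Vec.Functional.Properties using (updateAt-updates; updateAt-minimal)
open import Data.Product using (_×_; _,_; proj₁; proj₂)
open import Data.Sum using (_⊎_; inj₁; inj₂)
open import Function using (_∘_)
open import Relation.Nullary using (¬_; yes; no; contradiction; stable; ¬¬-map)
open import Relation.Binary.PropositionalEquality as ≡ using (_≡_; _≢_; cong-app)
open import Algebra.Bundles using (CommutativeRing)
open import Algebra.Morphism.Structures using (module RingMorphisms)
import Algebra.Properties.Semiring.Sum as SemiringSum
import Algebra.Properties.Ring as RingProperties
import Algebra.Properties.CommutativeSemigroup as CommutativeSemigroupProperties
import Algebra.Solver.Ring.NaturalCoefficients.Default as NaturalCoefficientsSolver
import Relation.Binary.Reasoning.Setoid as SetoidReasoning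

¬¬-∀ : ∀ {p} n {P : Fin n → Set p} → (∀ i → ¬ ¬ P i) → ¬ ¬ (∀ i → P i)
¬¬-∀ zero    ¬¬P ¬∀P = ¬∀P (λ ())
¬¬-∀ (suc n) ¬¬P ¬∀P =
  ¬¬P zero λ P₀ → ¬¬-∀ n (¬¬P ∘ suc) λ P₊ → ¬∀P (∀-cons P₀ P₊)

∀⊎-distrib : ∀ {p q} n {P : Fin n → Set p} {Q : Set q} →
             (∀ i → P i ⊎ Q) → (∀ i → P i) ⊎ Q
∀⊎-distrib zero    P⊎Q = inj₁ (λ ())
∀⊎-distrib (suc n) P⊎Q with P⊎Q zero | ∀⊎-distrib n (P⊎Q ∘ suc)
... | inj₂ q  | _        = inj₂ q
... | inj₁ _  | inj₂ q   = inj₂ q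
... | inj₁ P₀ | inj₁ P₊  = inj₁ (∀-cons P₀ P₊)

module FinSum {c ℓ} (R : CommutativeRing c ℓ) where
  open CommutativeRing R hiding (zero)
  open RingOps R using (∑)
  open RingProperties ring using (-0#≈0#; -‿+-comm)
  open SetoidReasoning setoid
  private module Sum = SemiringSum semiring

  ∑≡sum : ∀ n (f : Fin n → Carrier) → ∑ n f ≡ Sum.sum f
  ∑≡sum zero    f = ≡.refl
  ∑≡sum (suc n) f = ≡.cong (f zero +_) (∑≡sum n (λ i → f (suc i)))

  ∑-cong : ∀ n {f g : Fin n → Carrier} → (∀ i → f i ≈ g i) → ∑ n f ≈ ∑ n g
  ∑-cong n {f} {g} f≈g rewrite ∑≡sum n f | ∑≡sum n g = Sum.sum-cong-≋ f≈g

  ∑-zero : ∀ n {f : Fin n → Carrier} → (∀ i → f i ≈ 0#) → ∑ n f ≈ 0#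
  ∑-zero n {f} f≈0 = begin
    ∑ n f                   ≈⟨ ∑-cong n f≈0 ⟩
    ∑ n (λ _ → 0#)          ≡⟨ ∑≡sum n _ ⟩
    Sum.sum {n} (λ _ → 0#)  ≈⟨ Sum.sum-replicate-zero n ⟩
    0#                      ∎

  ∑-distrib-+ : ∀ n (f g : Fin n → Carrier) → ∑ n (λ i → f i + g i) ≈ ∑ n f + ∑ n g
  ∑-distrib-+ n f g
    rewrite ∑≡sum n (λ i → f i + g i) | ∑≡sum n f | ∑≡sum n g = Sum.∑-distrib-+ f g

  *-distribˡ-∑ : ∀ n x (f : Fin n → Carrier) → x * ∑ n f ≈ ∑ n (λ i → x * f i)
  *-distribˡ-∑ n x f rewrite ∑≡sum n f | ∑≡sum n (λ i → x * f i) = Sum.*-distribˡ-sum x f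

  ∑-linear : ∀ n α β (f g : Fin n → Carrier) →
             ∑ n (λ i → α * f i + β * g i) ≈ α * ∑ n f + β * ∑ n g
  ∑-linear n α β f g = trans (∑-distrib-+ n _ _) (sym (+-cong (*-distribˡ-∑ n α f) (*-distribˡ-∑ n β g)))

  ∑-neg : ∀ n (f : Fin n → Carrier) → ∑ n (λ i → - f i) ≈ - ∑ n f
  ∑-neg zero    f = sym -0#≈0#
  ∑-neg (suc n) f = trans (+-congˡ (∑-neg n (λ i → f (suc i)))) (-‿+-comm (f zero) _)

  ∑-comm : ∀ m n (f : Fin m → Fin n → Carrier) →
           ∑ m (λ i → ∑ n (f i)) ≈ ∑ n (λ j → ∑ m (λ i → f i j))
  ∑-comm m n f = begin
    ∑ m (λ i → ∑ n (f i))                  ≈⟨ ∑-cong m (λ i → reflexive (∑≡sum n (f i))) ⟩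
    ∑ m (λ i → Sum.sum (f i))              ≡⟨ ∑≡sum m _ ⟩
    Sum.sum (λ i → Sum.sum (f i))          ≈⟨ Sum.∑-comm f ⟩
    Sum.sum (λ j → Sum.sum (λ i → f i j))  ≡⟨ ∑≡sum n _ ⟨
    ∑ n (λ j → Sum.sum (λ i → f i j))      ≈⟨ ∑-cong n (λ j → reflexive (∑≡sum m (λ i → f i j))) ⟨
    ∑ n (λ j → ∑ m (λ i → f i j))          ∎

  ∑-punchIn : ∀ n (f : Fin (suc n) → Carrier) p → ∑ (suc n) f ≈ f p + ∑ n (λ i → f (punchIn p i))
  ∑-punchIn n f p
    rewrite ∑≡sum (suc n) f | ∑≡sum n (λ i → f (punchIn p i)) = Sum.sum-remove {i = p} f

  ∑-init-last : ∀ n (f : Fin (suc n) → Carrier) →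
                ∑ (suc n) f ≈ ∑ n (λ i → f (inject₁ i)) + f (fromℕ n)
  ∑-init-last n f
    rewrite ∑≡sum (suc n) f | ∑≡sum n (λ i → f (inject₁ i)) = Sum.sum-init-last f

  ∑-select : ∀ n (f : Fin n → Carrier) k → (∀ i → i ≢ k → f i ≈ 0#) → ∑ n f ≈ f k
  ∑-select zero    f ()
  ∑-select (suc n) f k f≈0 = begin
    ∑ (suc n) f                        ≈⟨ ∑-punchIn n f k ⟩
    f k + ∑ n (λ i → f (punchIn k i))  ≈⟨ +-congˡ (∑-zero n (λ i → f≈0 (punchIn k i) (punchInᵢ≢i k i))) ⟩
    f k + 0#                           ≈⟨ +-identityʳ (f k) ⟩
    f k                                ∎

module ZeroProducts {c ℓ} (R : CommutativeRing c ℓ) where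
  open CommutativeRing R hiding (zero)

  x≈0⇒x*y≈0 : ∀ {x y} → x ≈ 0# → x * y ≈ 0#
  x≈0⇒x*y≈0 {y = y} x≈0 = trans (*-congʳ x≈0) (zeroˡ y)

  y≈0⇒x*y≈0 : ∀ {x y} → y ≈ 0# → x * y ≈ 0#
  y≈0⇒x*y≈0 {x} y≈0 = trans (*-congˡ y≈0) (zeroʳ x)

module Determinant {c ℓ} (R : CommutativeRing c ℓ) where
  open CommutativeRing R hiding (zero)
  open RingOps R
  open FinSum R
  open ZeroProducts R
  open RingProperties ring using (-1*x≈-x; -‿distribˡ-*; -‿distribʳ-*; -‿injective; -0#≈0#; +-inverseʳ-unique)
  open CommutativeSemigroupProperties *-commutativeSemigroup using (x∙yz≈y∙xz)
  open NaturalCoefficientsSolver commutativeSemiring using (solve; _:+_; _:*_; _:=_)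
  open SetoidReasoning setoid

  private
    variable
      n : ℕ

  minor : Matrix (suc n) → Fin (suc n) → Matrix n
  minor M j i k = M (suc i) (punchIn j k)

  _ᵀ : Matrix n → Matrix n
  (M ᵀ) i j = M j i

  laplaceTerm : Matrix (suc n) → Fin (suc n) → Carrier
  laplaceTerm {n} M j = sign j * (M zero j * det n (minor M j))

  laplace-cong : ∀ (M : Matrix (suc n)) {f} → (∀ j → laplaceTerm M j ≈ f j) → det (suc n) M ≈ ∑ (suc n) f
  laplace-cong {n} M = ∑-cong (suc n) {laplaceTerm M}

  laplace-zero : ∀ (M : Matrix (suc n)) → (∀ j → laplaceTerm M j ≈ 0#) → det (suc n) M ≈ 0#
  laplace-zero {n} M = ∑-zero (suc n) {laplaceTerm M}

  det-cong : ∀ n {M N : Matrix n} → (∀ i j → M i j ≈ N i j) → det n M ≈ det n N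
  det-cong zero    M≈N = refl
  det-cong (suc n) {M} M≈N = laplace-cong M λ j →
    *-congˡ (*-cong (M≈N zero j) (det-cong n λ i k → M≈N (suc i) (punchIn j k)))

  det-zeroRow : ∀ n (M : Matrix n) r → (∀ b → M r b ≈ 0#) → det n M ≈ 0#
  det-zeroRow (suc n) M zero    M₀≈0 = laplace-zero M λ j → y≈0⇒x*y≈0 (x≈0⇒x*y≈0 (M₀≈0 j))
  det-zeroRow (suc n) M (suc r) Mr≈0 = laplace-zero M λ j →
    y≈0⇒x*y≈0 (y≈0⇒x*y≈0 (det-zeroRow n (minor M j) r (λ b → Mr≈0 (punchIn j b))))

  laplaceTerms₀₁-cancel : ∀ (M : Matrix (suc (suc n))) → (∀ i → M i zero ≈ M i (suc zero)) →
                          laplaceTerm M zero + laplaceTerm M (suc zero) ≈ 0#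
  laplaceTerms₀₁-cancel {n} M col₀≈col₁ = begin
    1# * t + - 1# * (M zero (suc zero) * det (suc n) (minor M (suc zero)))
      ≈⟨ +-congˡ (*-congˡ (*-cong (sym (col₀≈col₁ zero)) (det-cong (suc n) minor₁≈minor₀))) ⟩
    1# * t + - 1# * t  ≈⟨ +-cong (*-identityˡ t) (-1*x≈-x t) ⟩
    t + - t            ≈⟨ -‿inverseʳ t ⟩
    0#                 ∎
    where
    t = M zero zero * det (suc n) (minor M zero)
    minor₁≈minor₀ : ∀ i k → minor M (suc zero) i k ≈ minor M zero i k
    minor₁≈minor₀ i zero    = col₀≈col₁ (suc i)
    minor₁≈minor₀ i (suc k) = refl

  det-equalColumns01 : ∀ n (M : Matrix (suc (suc n))) → (∀ i → M i zero ≈ M i (suc zero)) →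
                       det (suc (suc n)) M ≈ 0#
  det-equalColumns01 zero    M col₀≈col₁ =
    trans (+-congˡ (+-identityʳ _)) (laplaceTerms₀₁-cancel M col₀≈col₁)
  det-equalColumns01 (suc n) M col₀≈col₁ = begin
    t₀ + (t₁ + ∑ (suc n) rest)  ≈⟨ +-assoc t₀ t₁ _ ⟨
    (t₀ + t₁) + ∑ (suc n) rest  ≈⟨ +-cong (laplaceTerms₀₁-cancel M col₀≈col₁) (∑-zero (suc n) rest≈0) ⟩
    0# + 0#                     ≈⟨ +-identityʳ 0# ⟩
    0#                          ∎
    where
    t₀ = laplaceTerm M zero
    t₁ = laplaceTerm M (suc zero)
    rest : Fin (suc n) → Carrier
    rest j = laplaceTerm M (suc (suc j))
    rest≈0 : ∀ j → rest j ≈ 0#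
    rest≈0 j = y≈0⇒x*y≈0 (y≈0⇒x*y≈0 (det-equalColumns01 n (minor M (suc (suc j))) (col₀≈col₁ ∘ suc)))

  sign-suc-swap : ∀ {m k} (i : Fin m) (j : Fin k) → sign (suc i) * sign j ≈ sign i * sign (suc j)
  sign-suc-swap i j = trans (sym (-‿distribˡ-* (sign i) (sign j))) (-‿distribʳ-* (sign i) (sign j))

  doubleMinor : Matrix (suc (suc n)) → Fin (suc n) → Fin (suc n) → Matrix n
  doubleMinor M a j x y = M (suc (punchIn a x)) (suc (punchIn j y))

  module TransposeStep (n : ℕ)
    (det-ᵀ₁ : ∀ (N : Matrix (suc n)) → det (suc n) (N ᵀ) ≈ det (suc n) N)
    (det-ᵀ₀ : ∀ (N : Matrix n) → det n (N ᵀ) ≈ det n N) where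

    crossTerm : Matrix (suc (suc n)) → Fin (suc n) → Fin (suc n) → Carrier
    crossTerm M j a =
      sign (suc j) * (M zero (suc j) * (sign a * (M (suc a) zero * det n (doubleMinor M a j))))

    -- expansion along the first row, then along the first column of each minor
    det-expand₂ : ∀ M → det (suc (suc n)) M ≈
                  laplaceTerm M zero + ∑ (suc n) (λ j → ∑ (suc n) (crossTerm M j))
    det-expand₂ M = +-congˡ (∑-cong (suc n) {λ j → laplaceTerm M (suc j)} expandMinor)
      where
      columnTerm : Fin (suc n) → Fin (suc n) → Carrier
      columnTerm j a = sign a * (M (suc a) zero * det n (doubleMinor M a j))

      expandMinor : ∀ j → laplaceTerm M (suc j) ≈ ∑ (suc n) (crossTerm M j)
      expandMinor j = begin
        sign (suc j) * (M zero (suc j) * det (suc n) (minor M (suc j)))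
          ≈⟨ *-congˡ (*-congˡ (det-ᵀ₁ (minor M (suc j)))) ⟨
        sign (suc j) * (M zero (suc j) * det (suc n) (minor M (suc j) ᵀ))
          ≈⟨ *-congˡ (*-congˡ (laplace-cong (minor M (suc j) ᵀ) λ a →
               *-congˡ (*-congˡ (det-ᵀ₀ (doubleMinor M a j))))) ⟩
        sign (suc j) * (M zero (suc j) * ∑ (suc n) (columnTerm j))
          ≈⟨ *-congˡ (*-distribˡ-∑ (suc n) (M zero (suc j)) (columnTerm j)) ⟩
        sign (suc j) * ∑ (suc n) (λ a → M zero (suc j) * columnTerm j a)
          ≈⟨ *-distribˡ-∑ (suc n) (sign (suc j)) (λ a → M zero (suc j) * columnTerm j a) ⟩
        ∑ (suc n) (crossTerm M j) ∎

    crossTerm-ᵀ : ∀ M j a → crossTerm (M ᵀ) a j ≈ crossTerm M j a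
    crossTerm-ᵀ M j a = begin
      sᵃ⁺ * (B * (sʲ * (A * D′)))  ≈⟨ solve 5 (λ s t x y d → s :* (y :* (t :* (x :* d))) := (s :* t) :* (x :* (y :* d))) refl sᵃ⁺ sʲ A B D′ ⟩
      (sᵃ⁺ * sʲ) * (A * (B * D′))  ≈⟨ *-cong (sign-suc-swap a j) (*-congˡ (*-congˡ (det-ᵀ₀ (doubleMinor M a j)))) ⟩
      (sᵃ * sʲ⁺) * (A * (B * D))   ≈⟨ solve 5 (λ s t x y d → (s :* t) :* (x :* (y :* d)) := t :* (x :* (s :* (y :* d)))) refl sᵃ sʲ⁺ A B D ⟩
      sʲ⁺ * (A * (sᵃ * (B * D)))   ∎
      where
      sᵃ = sign a
      sᵃ⁺ = sign (suc a)
      sʲ = sign j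
      sʲ⁺ = sign (suc j)
      A = M zero (suc j)
      B = M (suc a) zero
      D = det n (doubleMinor M a j)
      D′ = det n (doubleMinor M a j ᵀ)

    det-ᵀ₂ : ∀ M → det (suc (suc n)) (M ᵀ) ≈ det (suc (suc n)) M
    det-ᵀ₂ M = begin
      det (suc (suc n)) (M ᵀ)
        ≈⟨ det-expand₂ (M ᵀ) ⟩
      laplaceTerm (M ᵀ) zero + ∑ (suc n) (λ a → ∑ (suc n) (crossTerm (M ᵀ) a))
        ≈⟨ +-cong (*-congˡ (*-congˡ (det-ᵀ₁ (minor M zero)))) (∑-comm (suc n) (suc n) (crossTerm (M ᵀ))) ⟩
      laplaceTerm M zero + ∑ (suc n) (λ j → ∑ (suc n) (λ a → crossTerm (M ᵀ) a j))
        ≈⟨ +-congˡ (∑-cong (suc n) λ j → ∑-cong (suc n) λ a → crossTerm-ᵀ M j a) ⟩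
      laplaceTerm M zero + ∑ (suc n) (λ j → ∑ (suc n) (crossTerm M j))
        ≈⟨ det-expand₂ M ⟨
      det (suc (suc n)) M ∎

  det-transpose : ∀ n (M : Matrix n) → det n (M ᵀ) ≈ det n M
  det-transpose zero          M = refl
  det-transpose (suc zero)    M = refl
  det-transpose (suc (suc n)) M = TransposeStep.det-ᵀ₂ n (det-transpose (suc n)) (det-transpose n) M

  SameRowsExcept : Fin n → Matrix n → Matrix n → Set _
  SameRowsExcept r M N = ∀ i → i ≢ r → ∀ b → M i b ≈ N i b

  minor-sameRowsExcept : ∀ {M N : Matrix (suc n)} {r} → SameRowsExcept (suc r) M N →
                         ∀ j → SameRowsExcept r (minor M j) (minor N j)
  minor-sameRowsExcept M~N j i i≢r b = M~N (suc i) (i≢r ∘ suc-injective) (punchIn j b)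

  det-linearRow : ∀ n r (M N₁ N₂ : Matrix n) α β →
                  SameRowsExcept r M N₁ → SameRowsExcept r M N₂ →
                  (∀ b → M r b ≈ α * N₁ r b + β * N₂ r b) →
                  det n M ≈ α * det n N₁ + β * det n N₂
  det-linearRow (suc n) zero M N₁ N₂ α β M~N₁ M~N₂ M₀≈ =
    trans (laplace-cong M termwise) (∑-linear (suc n) α β (laplaceTerm N₁) (laplaceTerm N₂))
    where
    termwise : ∀ j → laplaceTerm M j ≈ α * laplaceTerm N₁ j + β * laplaceTerm N₂ j
    termwise j = begin
      sign j * (M zero j * D)
        ≈⟨ *-congˡ (*-congʳ (M₀≈ j)) ⟩
      sign j * ((α * N₁ zero j + β * N₂ zero j) * D)
        ≈⟨ solve 6 (λ s a x b y d → s :* ((a :* x :+ b :* y) :* d) := a :* (s :* (x :* d)) :+ b :* (s :* (y :* d)))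
                 refl (sign j) α (N₁ zero j) β (N₂ zero j) D ⟩
      α * (sign j * (N₁ zero j * D)) + β * (sign j * (N₂ zero j * D))
        ≈⟨ +-cong (*-congˡ (*-congˡ (*-congˡ (det-cong n λ i b → M~N₁ (suc i) (λ ()) (punchIn j b)))))
                  (*-congˡ (*-congˡ (*-congˡ (det-cong n λ i b → M~N₂ (suc i) (λ ()) (punchIn j b))))) ⟩
      α * laplaceTerm N₁ j + β * laplaceTerm N₂ j ∎
      where D = det n (minor M j)
  det-linearRow (suc n) (suc r) M N₁ N₂ α β M~N₁ M~N₂ Mr≈ =
    trans (laplace-cong M termwise) (∑-linear (suc n) α β (laplaceTerm N₁) (laplaceTerm N₂))
    where
    termwise : ∀ j → laplaceTerm M j ≈ α * laplaceTerm N₁ j + β * laplaceTerm N₂ j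
    termwise j = begin
      sign j * (M zero j * det n (minor M j))
        ≈⟨ *-congˡ (*-congˡ (det-linearRow n r (minor M j) (minor N₁ j) (minor N₂ j) α β
             (minor-sameRowsExcept M~N₁ j) (minor-sameRowsExcept M~N₂ j) (Mr≈ ∘ punchIn j))) ⟩
      sign j * (M zero j * (α * D₁ + β * D₂))
        ≈⟨ solve 6 (λ s x a b d e → s :* (x :* (a :* d :+ b :* e)) := a :* (s :* (x :* d)) :+ b :* (s :* (x :* e)))
                 refl (sign j) (M zero j) α β D₁ D₂ ⟩
      α * (sign j * (M zero j * D₁)) + β * (sign j * (M zero j * D₂))
        ≈⟨ +-cong (*-congˡ (*-congˡ (*-congʳ (M~N₁ zero (λ ()) j))))
                  (*-congˡ (*-congˡ (*-congʳ (M~N₂ zero (λ ()) j)))) ⟩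
      α * laplaceTerm N₁ j + β * laplaceTerm N₂ j ∎
      where
      D₁ = det n (minor N₁ j)
      D₂ = det n (minor N₂ j)

  _[_]≔_ : Matrix n → Fin n → (Fin n → Carrier) → Matrix n
  M [ r ]≔ u = updateAt M r (λ _ → u)

  []≔-updates : ∀ (M : Matrix n) r u b → (M [ r ]≔ u) r b ≈ u b
  []≔-updates M r u b = reflexive (cong-app (updateAt-updates r M) b)

  []≔-minimal : ∀ (M : Matrix n) r u → SameRowsExcept r (M [ r ]≔ u) M
  []≔-minimal M r u i i≢r b = reflexive (cong-app (updateAt-minimal i r M i≢r) b)

  det-additiveRow : ∀ n r (M N₁ N₂ : Matrix n) → SameRowsExcept r M N₁ → SameRowsExcept r M N₂ →
                    (∀ b → M r b ≈ N₁ r b + N₂ r b) → det n M ≈ det n N₁ + det n N₂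
  det-additiveRow n r M N₁ N₂ M~N₁ M~N₂ Mr≈ = begin
    det n M                            ≈⟨ det-linearRow n r M N₁ N₂ 1# 1# M~N₁ M~N₂ (λ b → trans (Mr≈ b) (sym 1*+1*)) ⟩
    1# * det n N₁ + 1# * det n N₂      ≈⟨ 1*+1* ⟩
    det n N₁ + det n N₂                ∎
    where
    1*+1* : ∀ {x y} → 1# * x + 1# * y ≈ x + y
    1*+1* = +-cong (*-identityˡ _) (*-identityˡ _)

  Alternating : ℕ → Set _
  Alternating n = ∀ (M : Matrix n) {r r'} → r ≢ r' → (∀ b → M r b ≈ M r' b) → det n M ≈ 0#

  module TwoRows (M : Matrix n) {r r' : Fin n} (r≢r' : r ≢ r') where

    withRows : (x y : Fin n → Carrier) → Matrix n
    withRows x y = (M [ r' ]≔ y) [ r ]≔ x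

    at-r : ∀ x y b → withRows x y r b ≈ x b
    at-r x y = []≔-updates (M [ r' ]≔ y) r x

    at-r' : ∀ x y b → withRows x y r' b ≈ y b
    at-r' x y b = trans ([]≔-minimal (M [ r' ]≔ y) r x r' (r≢r' ∘ ≡.sym) b) ([]≔-updates M r' y b)

    elsewhere : ∀ x y i → i ≢ r → i ≢ r' → ∀ b → withRows x y i b ≈ M i b
    elsewhere x y i i≢r i≢r' b = trans ([]≔-minimal _ r x i i≢r b) ([]≔-minimal M r' y i i≢r' b)

    withRows-char : ∀ (N : Matrix n) x y → (∀ b → N r b ≈ x b) → (∀ b → N r' b ≈ y b) →
                    (∀ i → i ≢ r → i ≢ r' → ∀ b → N i b ≈ M i b) → ∀ i b → N i b ≈ withRows x y i b
    withRows-char N x y Nr≈ Nr'≈ N≈M i b with i ≟ r | i ≟ r'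
    ... | yes ≡.refl | _          = trans (Nr≈ b) (sym (at-r x y b))
    ... | no _       | yes ≡.refl = trans (Nr'≈ b) (sym (at-r' x y b))
    ... | no i≢r     | no i≢r'    = trans (N≈M i i≢r i≢r' b) (sym (elsewhere x y i i≢r i≢r' b))

    additive-r : ∀ x y z → det n (withRows (λ b → x b + y b) z) ≈ det n (withRows x z) + det n (withRows y z)
    additive-r x y z = det-additiveRow n r _ _ _ (sameExcept x) (sameExcept y)
      (λ b → trans (at-r _ z b) (sym (+-cong (at-r x z b) (at-r y z b))))
      where
      sameExcept : ∀ x' → SameRowsExcept r (withRows (λ b → x b + y b) z) (withRows x' z)
      sameExcept x' i i≢r b = trans ([]≔-minimal _ r _ i i≢r b) (sym ([]≔-minimal _ r x' i i≢r b))

    additive-r' : ∀ x y z → det n (withRows x (λ b → y b + z b)) ≈ det n (withRows x y) + det n (withRows x z)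
    additive-r' x y z = det-additiveRow n r' _ _ _ (sameExcept y) (sameExcept z)
      (λ b → trans (at-r' x _ b) (sym (+-cong (at-r' x y b) (at-r' x z b))))
      where
      sameExcept : ∀ y' → SameRowsExcept r' (withRows x (λ b → y b + z b)) (withRows x y')
      sameExcept y' i i≢r' b with i ≟ r
      ... | yes ≡.refl = trans (at-r x _ b) (sym (at-r x y' b))
      ... | no i≢r     = trans (elsewhere x _ i i≢r i≢r' b) (sym (elsewhere x y' i i≢r i≢r' b))

  -- alternation is a hypothesis so that det-alternating can use this lemma on smaller minors
  det-swapRows : Alternating n → ∀ (M M' : Matrix n) {r r'} (r≢r' : r ≢ r') →
                 (∀ i → i ≢ r → i ≢ r' → ∀ b → M' i b ≈ M i b) →
                 (∀ b → M' r b ≈ M r' b) → (∀ b → M' r' b ≈ M r b) → det n M' ≈ - det n M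
  det-swapRows {n} alt M M' {r} {r'} r≢r' M'≈M M'r≈ M'r'≈ =
    +-inverseʳ-unique (det n M) (det n M') (begin
      det n M + det n M'
        ≈⟨ +-cong (det-cong n (withRows-char M u v (λ _ → refl) (λ _ → refl) (λ _ _ _ _ → refl)))
                  (det-cong n (withRows-char M' v u M'r≈ M'r'≈ M'≈M)) ⟩
      D u v + D v u
        ≈⟨ +-cong (+-identityˡ _) (+-identityʳ _) ⟨
      (0# + D u v) + (D v u + 0#)
        ≈⟨ +-cong (+-congʳ (repeated u)) (+-congˡ (repeated v)) ⟨
      (D u u + D u v) + (D v u + D v v)
        ≈⟨ +-cong (additive-r' u u v) (additive-r' v u v) ⟨
      D u w + D v w
        ≈⟨ additive-r u v w ⟨
      D w w
        ≈⟨ repeated w ⟩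
      0# ∎)
    where
    open TwoRows M r≢r'
    u = M r
    v = M r'
    w : Fin n → Carrier
    w b = u b + v b
    D : (x y : Fin n → Carrier) → Carrier
    D x y = det n (withRows x y)
    repeated : ∀ x → D x x ≈ 0#
    repeated x = alt (withRows x x) r≢r' (λ b → trans (at-r x x b) (sym (at-r' x x b)))

  -- rows 0, 1: transpose and cancel the first two Laplace terms;
  -- rows 0, a + 2: exchange rows 1 and a + 2, which swaps two rows in every minor
  det-equalRows₀ : ∀ n → Alternating (suc n) → ∀ (M : Matrix (suc (suc n))) a →
                   (∀ b → M zero b ≈ M (suc a) b) → det (suc (suc n)) M ≈ 0#
  det-equalRows₀ n alt M zero    M₀≈M₁ =
    trans (sym (det-transpose (suc (suc n)) M)) (det-equalColumns01 n (M ᵀ) M₀≈M₁)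
  det-equalRows₀ n alt M (suc a) M₀≈M = -‿injective (begin
    - det (suc (suc n)) M                        ≈⟨ ∑-neg (suc (suc n)) (laplaceTerm M) ⟨
    ∑ (suc (suc n)) (λ j → - laplaceTerm M j)  ≈⟨ laplace-cong M′ swappedTerm ⟨
    det (suc (suc n)) M′                         ≈⟨ det-equalRows₀ n alt M′ zero M′₀≈M′₁ ⟩
    0#                                           ≈⟨ -0#≈0# ⟨
    - 0#                                         ∎)
    where
    open TwoRows M {suc zero} {suc (suc a)} (λ ())
    x = M (suc (suc a))
    y = M (suc zero)
    M′ = withRows x y

    M′₀≈M′₁ : ∀ b → M′ zero b ≈ M′ (suc zero) b
    M′₀≈M′₁ b = trans (elsewhere x y zero (λ ()) (λ ()) b) (trans (M₀≈M b) (sym (at-r x y b)))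

    swappedTerm : ∀ j → laplaceTerm M′ j ≈ - laplaceTerm M j
    swappedTerm j = begin
      sign j * (M′ zero j * det (suc n) (minor M′ j))
        ≈⟨ *-congˡ (*-cong (elsewhere x y zero (λ ()) (λ ()) j)
             (det-swapRows alt (minor M j) (minor M′ j) {zero} {suc a} (λ ())
               (λ i i≢0 i≢a+1 b → elsewhere x y (suc i) (i≢0 ∘ suc-injective) (i≢a+1 ∘ suc-injective) (punchIn j b))
               (λ b → at-r x y (punchIn j b)) (λ b → at-r' x y (punchIn j b)))) ⟩
      sign j * (M zero j * - det (suc n) (minor M j))
        ≈⟨ trans (*-congˡ (sym (-‿distribʳ-* _ _))) (sym (-‿distribʳ-* _ _)) ⟩
      - laplaceTerm M j ∎

  det-alternating : ∀ n → Alternating n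
  det-alternating (suc n) M {zero} {zero} 0≢0 _ = contradiction ≡.refl 0≢0
  det-alternating (suc zero) M {zero} {suc ()}
  det-alternating (suc zero) M {suc ()}
  det-alternating (suc (suc n)) M {zero} {suc a} _ M₀≈Ma =
    det-equalRows₀ n (det-alternating (suc n)) M a M₀≈Ma
  det-alternating (suc (suc n)) M {suc a} {zero} _ Ma≈M₀ =
    det-equalRows₀ n (det-alternating (suc n)) M a (sym ∘ Ma≈M₀)
  det-alternating (suc (suc n)) M {suc a} {suc a'} a+1≢a'+1 Ma≈Ma' = laplace-zero M λ j →
    y≈0⇒x*y≈0 (y≈0⇒x*y≈0 (det-alternating (suc n) (minor M j) (a+1≢a'+1 ∘ ≡.cong suc) (Ma≈Ma' ∘ punchIn j)))

  det-rowSum : ∀ n (M : Matrix n) r m (μ : Fin m → Carrier) (N : Fin m → Matrix n) →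
               (∀ k → SameRowsExcept r M (N k)) → (∀ b → M r b ≈ ∑ m (λ k → μ k * N k r b)) →
               det n M ≈ ∑ m (λ k → μ k * det n (N k))
  det-rowSum n M r zero    μ N _ Mr≈ = det-zeroRow n M r Mr≈
  det-rowSum n M r (suc m) μ N M~N Mr≈ = begin
    det n M
      ≈⟨ det-linearRow n r M (N zero) M′ (μ zero) 1# (M~N zero) M~M′ Mr≈split ⟩
    μ zero * det n (N zero) + 1# * det n M′
      ≈⟨ +-congˡ (*-identityˡ _) ⟩
    μ zero * det n (N zero) + det n M′
      ≈⟨ +-congˡ (det-rowSum n M′ r m (μ ∘ suc) (N ∘ suc) M′~N ([]≔-updates M r rest)) ⟩
    ∑ (suc m) (λ k → μ k * det n (N k)) ∎
    where
    rest : Fin n → Carrier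
    rest b = ∑ m (λ k → μ (suc k) * N (suc k) r b)
    M′ = M [ r ]≔ rest

    M~M′ : SameRowsExcept r M M′
    M~M′ i i≢r b = sym ([]≔-minimal M r rest i i≢r b)

    Mr≈split : ∀ b → M r b ≈ μ zero * N zero r b + 1# * M′ r b
    Mr≈split b = trans (Mr≈ b) (+-congˡ (sym (trans (*-identityˡ _) ([]≔-updates M r rest b))))

    M′~N : ∀ k → SameRowsExcept r M′ (N (suc k))
    M′~N k i i≢r b = trans ([]≔-minimal M r rest i i≢r b) (M~N (suc k) i i≢r b)

  det-rowDependency : ∀ n (M : Matrix n) (λs : Fin n → Carrier) →
                      (∀ b → ∑ n (λ k → λs k * M k b) ≈ 0#) → ∀ j → λs j * det n M ≈ 0#
  det-rowDependency n M λs dependency j = begin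
    λs j * det n M                  ≈⟨ *-congˡ (det-cong n Nj≈M) ⟨
    λs j * det n (N j)              ≈⟨ ∑-select n (λ k → λs k * det n (N k)) j N-repeated ⟨
    ∑ n (λ k → λs k * det n (N k))  ≈⟨ det-rowSum n Z j n λs N Z~N Zj≈ ⟨
    det n Z                         ≈⟨ det-zeroRow n Z j ([]≔-updates M j zeros) ⟩
    0#                              ∎
    where
    zeros : Fin n → Carrier
    zeros _ = 0#
    Z = M [ j ]≔ zeros
    N : Fin n → Matrix n
    N k = M [ j ]≔ M k

    Nj≈M : ∀ i b → N j i b ≈ M i b
    Nj≈M i b with i ≟ j
    ... | yes ≡.refl = []≔-updates M j (M j) b
    ... | no i≢j     = []≔-minimal M j (M j) i i≢j b

    N-repeated : ∀ k → k ≢ j → λs k * det n (N k) ≈ 0#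
    N-repeated k k≢j = y≈0⇒x*y≈0 (det-alternating n (N k) (k≢j ∘ ≡.sym)
      (λ b → trans ([]≔-updates M j (M k) b) (sym ([]≔-minimal M j (M k) k k≢j b))))

    Z~N : ∀ k → SameRowsExcept j Z (N k)
    Z~N k i i≢j b = trans ([]≔-minimal M j zeros i i≢j b) (sym ([]≔-minimal M j (M k) i i≢j b))

    Zj≈ : ∀ b → Z j b ≈ ∑ n (λ k → λs k * N k j b)
    Zj≈ b = trans ([]≔-updates M j zeros b)
      (sym (trans (∑-cong n λ k → *-congˡ ([]≔-updates M j (M k) b)) (dependency b)))

  det-columnDependency : ∀ n (M : Matrix n) (λs : Fin n → Carrier) →
                         (∀ i → ∑ n (λ k → λs k * M i k) ≈ 0#) → ∀ j → λs j * det n M ≈ 0#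
  det-columnDependency n M λs dependency j =
    trans (*-congˡ (sym (det-transpose n M))) (det-rowDependency n (M ᵀ) λs dependency j)

  swap₀₁ : Matrix (suc (suc n)) → Matrix (suc (suc n))
  swap₀₁ M zero          = M (suc zero)
  swap₀₁ M (suc zero)    = M zero
  swap₀₁ M (suc (suc a)) = M (suc (suc a))

  det-swap₀₁ : ∀ (M : Matrix (suc (suc n))) → det (suc (suc n)) (swap₀₁ M) ≈ - det (suc (suc n)) M
  det-swap₀₁ M = det-swapRows (det-alternating _) M (swap₀₁ M) {zero} {suc zero} (λ ())
    (λ { zero 0≢0 → contradiction ≡.refl 0≢0
       ; (suc zero) _ 1≢1 → contradiction ≡.refl 1≢1
       ; (suc (suc a)) _ _ b → refl })
    (λ _ → refl) (λ _ → refl)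

  AddsMultiplesOfRow : Fin n → (Fin n → Carrier) → Matrix n → Matrix n → Set _
  AddsMultiplesOfRow p c P P′ =
    (∀ b → P′ p b ≈ P p b) × (∀ a → a ≢ p → ∀ b → P′ a b ≈ P a b + c a * P p b)

  det-addRowMultiples-suc : ∀ n → (∀ (P P′ : Matrix n) p c → AddsMultiplesOfRow p c P P′ → det n P′ ≈ det n P) →
                           ∀ (P P′ : Matrix (suc n)) p (c : Fin (suc n) → Carrier) →
                           AddsMultiplesOfRow (suc p) c P P′ →
                           det (suc n) P′ ≈ det (suc n) P
  det-addRowMultiples-suc n IH P P′ p c (P′p≈ , P′a≈) = begin
    det (suc n) P′
      ≈⟨ det-linearRow (suc n) zero P′ Q Q′ 1# (c zero) (P′~ (P zero)) (P′~ (P (suc p))) P′₀≈split ⟩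
    1# * det (suc n) Q + c zero * det (suc n) Q′
      ≈⟨ +-cong (*-identityˡ _) (y≈0⇒x*y≈0 det-Q′≈0) ⟩
    det (suc n) Q + 0#
      ≈⟨ +-identityʳ _ ⟩
    det (suc n) Q
      ≈⟨ laplace-cong Q (λ j → *-congˡ (*-cong ([]≔-updates P′ zero (P zero) j)
           (IH (minor P j) (minor Q j) p (c ∘ suc) (minor-op j)))) ⟩
    det (suc n) P ∎
    where
    Q = P′ [ zero ]≔ P zero
    Q′ = P′ [ zero ]≔ P (suc p)

    P′~ : ∀ u → SameRowsExcept zero P′ (P′ [ zero ]≔ u)
    P′~ u i i≢0 b = sym ([]≔-minimal P′ zero u i i≢0 b)

    P′₀≈split : ∀ b → P′ zero b ≈ 1# * Q zero b + c zero * Q′ zero b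
    P′₀≈split b = trans (P′a≈ zero (λ ()) b)
      (sym (+-cong (trans (*-identityˡ _) ([]≔-updates P′ zero (P zero) b))
                   (*-congˡ ([]≔-updates P′ zero (P (suc p)) b))))

    det-Q′≈0 : det (suc n) Q′ ≈ 0#
    det-Q′≈0 = det-alternating (suc n) Q′ {zero} {suc p} (λ ()) λ b →
      trans ([]≔-updates P′ zero (P (suc p)) b) (sym (trans (sym (P′~ (P (suc p)) (suc p) (λ ()) b)) (P′p≈ b)))

    minor-op : ∀ j → AddsMultiplesOfRow p (c ∘ suc) (minor P j) (minor Q j)
    minor-op j = (λ b → trans (sym (P′~ (P zero) (suc p) (λ ()) (punchIn j b))) (P′p≈ (punchIn j b)))
               , (λ a a≢p b → trans (sym (P′~ (P zero) (suc a) (λ ()) (punchIn j b)))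
                                    (P′a≈ (suc a) (a≢p ∘ suc-injective) (punchIn j b)))

  det-addRowMultiples : ∀ n (P P′ : Matrix n) p (c : Fin n → Carrier) → AddsMultiplesOfRow p c P P′ →
                        det n P′ ≈ det n P
  det-addRowMultiples (suc n) P P′ (suc p) c op =
    det-addRowMultiples-suc n (det-addRowMultiples n) P P′ p c op
  det-addRowMultiples (suc zero) P P′ zero c (P′₀≈ , _) = det-cong 1 {P′} {P} λ { zero b → P′₀≈ b }
  det-addRowMultiples (suc (suc n)) P P′ zero c (P′₀≈ , P′a≈) = -‿injective (begin
    - det (suc (suc n)) P′       ≈⟨ det-swap₀₁ P′ ⟨
    det (suc (suc n)) (swap₀₁ P′) ≈⟨ det-addRowMultiples-suc (suc n) (det-addRowMultiples (suc n))
                                       (swap₀₁ P) (swap₀₁ P′) zero c′ swapped-op ⟩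
    det (suc (suc n)) (swap₀₁ P)  ≈⟨ det-swap₀₁ P ⟩
    - det (suc (suc n)) P        ∎)
    where
    c′ : Fin (suc (suc n)) → Carrier
    c′ zero    = c (suc zero)
    c′ (suc a) = c (suc a)

    swapped-op : AddsMultiplesOfRow (suc zero) c′ (swap₀₁ P) (swap₀₁ P′)
    swapped-op = P′₀≈ , λ
      { zero          _   → P′a≈ (suc zero) (λ ())
      ; (suc zero)    1≢1 → contradiction ≡.refl 1≢1
      ; (suc (suc a)) _   → P′a≈ (suc (suc a)) (λ ())
      }

  det-firstRowDiagonal : ∀ n (M : Matrix (suc n)) → (∀ j → M zero (suc j) ≈ 0#) →
                         det (suc n) M ≈ M zero zero * det n (minor M zero)
  det-firstRowDiagonal n M M₀≈0 = begin
    1# * (M zero zero * det n (minor M zero)) + ∑ n (λ j → laplaceTerm M (suc j))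
      ≈⟨ +-cong (*-identityˡ _) (∑-zero n λ j → y≈0⇒x*y≈0 (x≈0⇒x*y≈0 (M₀≈0 j))) ⟩
    M zero zero * det n (minor M zero) + 0#
      ≈⟨ +-identityʳ _ ⟩
    M zero zero * det n (minor M zero) ∎

  det-diagonal : ∀ n (M : Matrix n) (d : Fin n → Carrier) → (∀ a → M a a ≈ d a) → (∀ a b → a ≢ b → M a b ≈ 0#) →
                 det n M ≈ ∏ n d
  det-diagonal zero    M d _    _   = refl
  det-diagonal (suc n) M d diag off = trans (det-firstRowDiagonal n M (λ j → off zero (suc j) (λ ())))
    (*-cong (diag zero) (det-diagonal n (minor M zero) (d ∘ suc) (diag ∘ suc)
                           (λ a b a≢b → off (suc a) (suc b) (a≢b ∘ suc-injective))))

  det-diagonalExceptRow : ∀ n (M : Matrix (suc n)) i (w d : Fin (suc n) → Carrier) → (∀ b → M i b ≈ w b) →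
                          (∀ a → a ≢ i → M a a ≈ d a) → (∀ a b → a ≢ i → a ≢ b → M a b ≈ 0#) →
                          det (suc n) M ≈ w i * ∏ n (λ k → d (punchIn i k))
  det-diagonalExceptRow n M zero w d M₀≈w diag off = begin
    1# * (M zero zero * det n (minor M zero)) + ∑ n (λ j → laplaceTerm M (suc j))
      ≈⟨ +-cong (*-identityˡ _) (∑-zero n λ j → y≈0⇒x*y≈0 (y≈0⇒x*y≈0 (det-zeroRow n (minor M (suc j)) j λ b →
           off (suc j) (punchIn (suc j) b) (λ ()) (punchInᵢ≢i (suc j) b ∘ ≡.sym)))) ⟩
    M zero zero * det n (minor M zero) + 0#
      ≈⟨ +-identityʳ _ ⟩
    M zero zero * det n (minor M zero)
      ≈⟨ *-cong (M₀≈w zero) (det-diagonal n (minor M zero) (d ∘ suc) (λ a → diag (suc a) (λ ()))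
           (λ a b a≢b → off (suc a) (suc b) (λ ()) (a≢b ∘ suc-injective))) ⟩
    w zero * ∏ n (d ∘ suc) ∎
  det-diagonalExceptRow zero    M (suc ())
  det-diagonalExceptRow (suc n) M (suc i) w d Mi≈w diag off = begin
    det (suc (suc n)) M
      ≈⟨ det-firstRowDiagonal (suc n) M (λ j → off zero (suc j) (λ ()) (λ ())) ⟩
    M zero zero * det (suc n) (minor M zero)
      ≈⟨ *-cong (diag zero (λ ())) (det-diagonalExceptRow n (minor M zero) i (w ∘ suc) (d ∘ suc) (Mi≈w ∘ suc)
           (λ a a≢i → diag (suc a) (a≢i ∘ suc-injective))
           (λ a b a≢i a≢b → off (suc a) (suc b) (a≢i ∘ suc-injective) (a≢b ∘ suc-injective))) ⟩
    d zero * (w (suc i) * ∏ n (λ k → d (suc (punchIn i k))))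
      ≈⟨ x∙yz≈y∙xz _ _ _ ⟩
    w (suc i) * (d zero * ∏ n (λ k → d (suc (punchIn i k)))) ∎

  det≈0⇒Δ≈0 : ∀ m (Y : Fin (suc (suc (suc m))) → Matrix (suc (suc m))) →
              det (suc (suc m)) (matSum (suc (suc m)) (λ ℓ → Y (inject₁ ℓ))) ≈ 0# → Δ (suc (suc m)) Y ≈ 0#
  -- the exponent 2n ∸ 2 only reduces to a successor once m is split
  det≈0⇒Δ≈0 zero    Y det≈0 = x≈0⇒x*y≈0 (x≈0⇒x*y≈0 det≈0)
  det≈0⇒Δ≈0 (suc m) Y det≈0 = x≈0⇒x*y≈0 (x≈0⇒x*y≈0 det≈0)

module FieldProperties {c ℓ} (K : CommutativeRing c ℓ) (isField : IsField K) where
  open CommutativeRing K hiding (zero)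
  open RingOps K
  open IsField isField
  open ZeroProducts K using (x≈0⇒x*y≈0)
  open SetoidReasoning setoid

  x*y≈0⇒x≈0 : ∀ {x y} → y ≉ 0# → x * y ≈ 0# → x ≈ 0#
  x*y≈0⇒x≈0 {x} {y} y≉0 xy≈0 with inverse y y≉0
  ... | y⁻¹ , yy⁻¹≈1 = begin
    x               ≈⟨ *-identityʳ x ⟨
    x * 1#          ≈⟨ *-congˡ yy⁻¹≈1 ⟨
    x * (y * y⁻¹)   ≈⟨ *-assoc x y y⁻¹ ⟨
    (x * y) * y⁻¹   ≈⟨ x≈0⇒x*y≈0 xy≈0 ⟩
    0#              ∎

  *-≉0 : ∀ {x y} → x ≉ 0# → y ≉ 0# → x * y ≉ 0#
  *-≉0 x≉0 y≉0 = x≉0 ∘ x*y≈0⇒x≈0 y≉0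

  ∏-≉0 : ∀ n (f : Fin n → Carrier) → (∀ i → f i ≉ 0#) → ∏ n f ≉ 0#
  ∏-≉0 zero    f _   = 1≉0
  ∏-≉0 (suc n) f f≉0 = *-≉0 (f≉0 zero) (∏-≉0 n (f ∘ suc) (f≉0 ∘ suc))

  ^-≉0 : ∀ k {x} → x ≉ 0# → x ^ k ≉ 0#
  ^-≉0 zero    _   = 1≉0
  ^-≉0 (suc k) x≉0 = *-≉0 x≉0 (^-≉0 k x≉0)

module NormalizedEvaluations {c ℓ} (K : CommutativeRing c ℓ) (isField : IsField K) where
  open CommutativeRing K hiding (zero)
  open RingOps K
  open FinSum K
  open Determinant K
  open FieldProperties K isField
  open IsField isField using (1≉0)
  open RingProperties ring using (+-cancelˡ)
  open SetoidReasoning setoid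

  module _ {m} (Y : Fin (suc (suc m)) → Matrix (suc m))
    (offSupport : ∀ a b ℓ → ¬ (a ≡ b × b ≡ ℓ) → Y (inject₁ ℓ) a b ≈ 0#)
    (onSupport : ∀ a → Y (inject₁ a) a a ≉ 0#)
    (lastOnes : ∀ a b → Y (fromℕ (suc m)) a b ≈ 1#) where

    n = suc m

    M : Matrix n
    M = matSum n (λ ℓ → Y (inject₁ ℓ))

    N : Fin n → Matrix n
    N i = matSum n (λ ℓ → Y (punchIn (inject₁ i) ℓ))

    d : Fin n → Carrier
    d a = Y (inject₁ a) a a

    M≈Y : ∀ a b → M a b ≈ Y (inject₁ a) a b
    M≈Y a b = ∑-select n (λ ℓ → Y (inject₁ ℓ) a b) a λ ℓ ℓ≢a →
      offSupport a b ℓ λ (a≡b , b≡ℓ) → ℓ≢a (≡.sym (≡.trans a≡b b≡ℓ))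

    M-offDiagonal : ∀ a b → a ≢ b → M a b ≈ 0#
    M-offDiagonal a b a≢b = trans (M≈Y a b) (offSupport a b a (a≢b ∘ proj₁))

    det-M≉0 : det n M ≉ 0#
    det-M≉0 = ∏-≉0 n d onSupport ∘ trans (sym (det-diagonal n M d (λ a → M≈Y a a) M-offDiagonal))

    Y+N : ∀ i a b → Y (inject₁ i) a b + N i a b ≈ M a b + 1#
    Y+N i a b = begin
      Y (inject₁ i) a b + N i a b  ≈⟨ ∑-punchIn n (λ ℓ → Y ℓ a b) (inject₁ i) ⟨
      ∑ (suc n) (λ ℓ → Y ℓ a b)    ≈⟨ ∑-init-last n (λ ℓ → Y ℓ a b) ⟩
      M a b + Y (fromℕ n) a b      ≈⟨ +-congˡ (lastOnes a b) ⟩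
      M a b + 1#                   ∎

    N-row : ∀ i b → N i i b ≈ 1#
    N-row i b = +-cancelˡ (Y (inject₁ i) i b) _ _ (trans (Y+N i i b) (+-congʳ (M≈Y i b)))

    N-otherRow : ∀ i a → a ≢ i → ∀ b → N i a b ≈ M a b + 1#
    N-otherRow i a a≢i b = begin
      N i a b                      ≈⟨ +-identityˡ _ ⟨
      0# + N i a b                 ≈⟨ +-congʳ (offSupport a b i λ (a≡b , b≡i) → a≢i (≡.trans a≡b b≡i)) ⟨
      Y (inject₁ i) a b + N i a b  ≈⟨ Y+N i a b ⟩
      M a b + 1#                   ∎

    det-N≉0 : ∀ i → det n (N i) ≉ 0#
    det-N≉0 i = *-≉0 1≉0 (∏-≉0 m (d ∘ punchIn i) (onSupport ∘ punchIn i)) ∘ trans (sym det-N≈)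
      where
      ones : Fin n → Carrier
      ones _ = 1#
      P = M [ i ]≔ ones

      N-fromP : AddsMultiplesOfRow i ones P (N i)
      N-fromP = (λ b → trans (N-row i b) (sym ([]≔-updates M i ones b)))
              , λ a a≢i b → trans (N-otherRow i a a≢i b)
                  (sym (+-cong ([]≔-minimal M i ones a a≢i b) (trans (*-identityˡ _) ([]≔-updates M i ones b))))

      det-N≈ : det n (N i) ≈ 1# * ∏ m (d ∘ punchIn i)
      det-N≈ = trans (det-addRowMultiples n P (N i) i ones N-fromP)
        (det-diagonalExceptRow m P i ones d ([]≔-updates M i ones)
          (λ a a≢i → trans ([]≔-minimal M i ones a a≢i a) (M≈Y a a))
          (λ a b a≢i a≢b → trans ([]≔-minimal M i ones a a≢i b) (M-offDiagonal a b a≢b)))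

    Δ≉0 : Δ n Y ≉ 0#
    Δ≉0 = *-≉0 (^-≉0 (2 ℕ.* n ℕ.∸ 2) det-M≉0) (∏-≉0 n _ (λ i → ^-≉0 2 (det-N≉0 i)))

module Proposition {c ℓ a ℓa} {K : CommutativeRing c ℓ} (isField : IsField K) (A : KAlgebra K a ℓa) where
  open CommutativeRing K hiding (zero)
  open RingOps K
  open FinSum K
  open Determinant K
  open FieldProperties K isField
  open KAlgebra A using (ι; _·_)
  private
    module A where
      open CommutativeRing (KAlgebra.ring A) public
      open RingOps (KAlgebra.ring A) public using (∑)
      open FinSum (KAlgebra.ring A) public using (∑-cong; *-distribˡ-∑)
      open ZeroProducts (KAlgebra.ring A) public using (y≈0⇒x*y≈0)
      open RingProperties (CommutativeRing.ring (KAlgebra.ring A)) public using (x∙y⁻¹≈ε⇒x≈y)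
      open CommutativeSemigroupProperties (CommutativeRing.*-commutativeSemigroup (KAlgebra.ring A)) public
        using (x∙yz≈y∙xz)

  module _ (s : KAlgHom A) where
    open RingMorphisms.IsRingHomomorphism (KAlgHom.φ-hom s)

    φ-zero : ∀ {x} → x A.≈ A.0# → φ s x ≈ 0#
    φ-zero x≈0 = trans (⟦⟧-cong x≈0) 0#-homo

    φ-linearCombination : ∀ n (λs : Fin n → Carrier) (v : Fin n → A.Carrier) →
                          φ s (A.∑ n (λ k → λs k · v k)) ≈ ∑ n (λ k → λs k * φ s (v k))
    φ-linearCombination zero    λs v = 0#-homo
    φ-linearCombination (suc n) λs v = trans (+-homo _ _)
      (+-cong (trans (*-homo _ _) (*-congʳ (KAlgHom.φ-ι s (λs zero))))
              (φ-linearCombination n (λs ∘ suc) (v ∘ suc)))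

  -- also for i ≡ i' or j ≡ j', which RankLe1 leaves out
  rankLe1-cross : ∀ {n} {X : MatrixA A n} → RankLe1 A X →
                  ∀ i i' j j' → X i j A.* X i' j' A.≈ X i' j A.* X i j'
  rankLe1-cross rk i i' j j' with i ≟ i' | j ≟ j'
  ... | yes ≡.refl | _          = A.refl
  ... | no _       | yes ≡.refl = A.*-comm _ _
  ... | no i≢i'    | no j≢j'    = A.trans (A.x∙y⁻¹≈ε⇒x≈y _ _ (rk i i' j j' i≢i' j≢j')) (A.*-comm _ _)

  rankLe1-transpose : ∀ {n} {X : MatrixA A n} → RankLe1 A X → RankLe1 A (λ i j → X j i)
  rankLe1-transpose rk i i' j j' i≢i' j≢j' =
    A.trans (A.+-congˡ (A.-‿cong (A.*-comm _ _))) (rk j j' i i' j≢j' i≢i')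

  row₀-independent : NoZeroDivisors A → ∀ {n m} (X : MatrixA A (suc n)) (t : Fin m → KAlgHom A) →
                     RankLe1 A X → det (suc n) (matSum m (λ ℓ → _∣at_ A X (t ℓ))) ≉ 0# →
                     LinIndep A (suc n) (X zero)
  row₀-independent noZeroDivisors {n} {m} X t rk det≉0 λs row₀-relation j =
    x*y≈0⇒x≈0 det≉0 (det-columnDependency (suc n) M λs M-relation j)
    where
    M = matSum m (λ ℓ → _∣at_ A X (t ℓ))

    combination : Fin (suc n) → A.Carrier
    combination i = A.∑ (suc n) (λ k → λs k · X i k)

    row₀*combination≈0 : ∀ i j₀ → X zero j₀ A.* combination i A.≈ A.0#
    row₀*combination≈0 i j₀ = begin
      X zero j₀ A.* combination i
        ≈⟨ A.*-distribˡ-∑ (suc n) (X zero j₀) (λ k → λs k · X i k) ⟩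
      A.∑ (suc n) (λ k → X zero j₀ A.* (λs k · X i k))
        ≈⟨ A.∑-cong (suc n) (λ k → A.trans (A.x∙yz≈y∙xz (X zero j₀) (ι (λs k)) (X i k))
             (A.trans (A.*-congˡ (rankLe1-cross rk zero i j₀ k)) (A.x∙yz≈y∙xz (ι (λs k)) (X i j₀) (X zero k)))) ⟩
      A.∑ (suc n) (λ k → X i j₀ A.* (λs k · X zero k))
        ≈⟨ A.*-distribˡ-∑ (suc n) (X i j₀) (λ k → λs k · X zero k) ⟨
      X i j₀ A.* A.∑ (suc n) (λ k → λs k · X zero k)
        ≈⟨ A.y≈0⇒x*y≈0 row₀-relation ⟩
      A.0# ∎
      where open SetoidReasoning A.setoid

    combination≈0 : ∀ i → combination i A.≈ A.0#
    combination≈0 i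
      with ∀⊎-distrib (suc n) (λ j₀ → noZeroDivisors (X zero j₀) (combination i) (row₀*combination≈0 i j₀))
    ... | inj₂ combination≈0 = combination≈0
    ... | inj₁ row₀≈0 =
      contradiction (det-zeroRow (suc n) M zero λ b → ∑-zero m λ ℓ → φ-zero (t ℓ) (row₀≈0 b)) det≉0

    M-relation : ∀ i → ∑ (suc n) (λ k → λs k * M i k) ≈ 0#
    M-relation i = begin
      ∑ (suc n) (λ k → λs k * ∑ m (λ ℓ → φ (t ℓ) (X i k)))
        ≈⟨ ∑-cong (suc n) (λ k → *-distribˡ-∑ m (λs k) (λ ℓ → φ (t ℓ) (X i k))) ⟩
      ∑ (suc n) (λ k → ∑ m (λ ℓ → λs k * φ (t ℓ) (X i k)))
        ≈⟨ ∑-comm (suc n) m (λ k ℓ → λs k * φ (t ℓ) (X i k)) ⟩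
      ∑ m (λ ℓ → ∑ (suc n) (λ k → λs k * φ (t ℓ) (X i k)))
        ≈⟨ ∑-cong m (λ ℓ → φ-linearCombination (t ℓ) (suc n) λs (X i)) ⟨
      ∑ m (λ ℓ → φ (t ℓ) (combination i))
        ≈⟨ ∑-zero m (λ ℓ → φ-zero (t ℓ) (combination≈0 i)) ⟩
      0# ∎
      where open SetoidReasoning setoid

  Δ≉0⇒kGeneral : NoZeroDivisors A → ∀ m (X : MatrixA A (suc (suc m))) (s : Fin (suc (suc (suc m))) → KAlgHom A) →
                 RankLe1 A X → Δ (suc (suc m)) (λ ℓ → _∣at_ A X (s ℓ)) ≉ 0# → KGeneral A X
  Δ≉0⇒kGeneral noZeroDivisors m X s rk Δ≉0 =
      (zero , row₀-independent noZeroDivisors X t rk det≉0)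
    , (zero , row₀-independent noZeroDivisors (λ i j → X j i) t (rankLe1-transpose rk)
                (det≉0 ∘ trans (sym (det-transpose _ M))))
    where
    t = s ∘ inject₁
    M = matSum (suc (suc m)) (λ ℓ → _∣at_ A X (t ℓ))
    det≉0 : det (suc (suc m)) M ≉ 0#
    det≉0 = Δ≉0 ∘ det≈0⇒Δ≈0 m (λ ℓ → _∣at_ A X (s ℓ))

  -- equality in k need not be decidable, so the support condition of a normalized X
  -- only gives the vanishing of the other entries up to double negation; this
  -- suffices because the conclusion of (i) is a negation
  normalized⇒¬¬offSupport : ∀ {n} (X : MatrixA A n) s → Normalized A X s →
                            ¬ ¬ (∀ i j ℓ → ¬ (i ≡ j × j ≡ ℓ) → φ (s (inject₁ ℓ)) (X i j) ≈ 0#)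
  normalized⇒¬¬offSupport {n} X s (support , _) =
    ¬¬-∀ n λ i → ¬¬-∀ n λ j → ¬¬-∀ n λ ℓ →
      ¬¬-map (λ stable-≈0 ¬diag → stable-≈0 (¬diag ∘ proj₁ (support i j ℓ))) stable

  normalized⇒Δ≉0 : ∀ m (X : MatrixA A (suc m)) (s : Fin (suc (suc m)) → KAlgHom A) →
                   Normalized A X s → Δ (suc m) (λ ℓ → _∣at_ A X (s ℓ)) ≉ 0#
  normalized⇒Δ≉0 m X s normalized@(support , lastOnes) Δ≈0 =
    normalized⇒¬¬offSupport X s normalized λ offSupport →
      NormalizedEvaluations.Δ≉0 K isField (λ ℓ → _∣at_ A X (s ℓ)) offSupport
        (λ a → proj₂ (support a a a) (≡.refl , ≡.refl)) lastOnes Δ≈0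

proposition3p5p2 : ∀ {c ℓ a ℓa : Level} (K : CommutativeRing c ℓ) →
    IsField K → AlgebraicallyClosed K →
    (A : KAlgebra K a ℓa) → FinitelyGenerated A → NoZeroDivisors A →
    (n : ℕ) → 2 ≤ n →
    (X : MatrixA A n) → RankLe1 A X →
    (s : Fin (suc n) → KAlgHom A) →
    (Normalized A X s →
       ¬ CommutativeRing._≈_ K (RingOps.Δ K n (λ ℓ' → _∣at_ A X (s ℓ'))) (CommutativeRing.0# K)) ×
    (¬ CommutativeRing._≈_ K (RingOps.Δ K n (λ ℓ' → _∣at_ A X (s ℓ'))) (CommutativeRing.0# K) →
       KGeneral A X)
proposition3p5p2 K isField _ A _ noZeroDivisors (suc (suc m)) (s≤s (s≤s z≤n)) X rk s =
    Proposition.normalized⇒Δ≉0 isField A (suc m) X s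
  , Proposition.Δ≉0⇒kGeneral isField A noZeroDivisors m X s rk
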